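{- Let $G$ be a dicotic nonzugzwang scoring game and let $t\geq 0$. Then $0\leq Ls(G)-Ls(G_t)\leq t$ and $0\geq Rs(G)-Rs(G_t)\geq -t$.
   Context: A (short) scoring game is defined recursively as $G=\langle G^L\mid G^R\rangle$, where each of $G^L$, $G^R$ is either a finite nonempty set of scoring games (the Left, resp. Right, options) or a symbol $\emptyset^s$ with $s\in\mathbb R$ (that player cannot move and the game ends with score $s$ if it is that player's turn); the real $s$ denotes $\langle\emptyset^s\mid\emptyset^s\rangle$. Scores: $Ls(\langle\emptyset^s\mid G^R\rangle)=s$, $Rs(\langle G^L\mid\emptyset^s\rangle)=s$, $Ls(G)=\max_{G^l\in G^L}Rs(G^l)$, $Rs(G)=\min_{G^r\in G^R}Ls(G^r)$ when these sides are sets. Positions: $G$ and recursively positions of options. Sums $G_1+G_2$: Left options all $G_1^l+G_2$ and $G_1+G_2^l$ (if none, Left side $\emptyset^{\ell_1+\ell_2}$), symmetrically for Right; adding a real $x$ means adding the number $x$. Dicotic: every position has Left options iff it has Right options; nonzugzwang: $Ls(H)\ge Rs(H)$ for all positions $H$. Cooling: if $G$ is a number $k$, $G_t=k$ and $\sigma(G)=0$; otherwise $\widetilde G_t=\langle\{G^l_t-t: G^l\in G^L\}\mid\{G^r_t+t: G^r\in G^R\}\rangle$, $\sigma(G)=\min\{t\ge0: Ls(\widetilde G_t)=Rs(\widetilde G_t)\}$ (which exists), $G_t=\widetilde G_t$ for $t\le\sigma(G)$ and $G_t$ is the number $Ls(\widetilde G_{\sigma(G)})$ for $t>\sigma(G)$.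 -}

module Defs where

open import Data.Product using (Σ; _×_; _,_; ∃)
open import Data.Sum using (_⊎_)
open import Data.List using (List; []; _∷_)
open import Data.List.NonEmpty using (List⁺; _∷_; toList)
open import Data.List.Membership.Propositional using (_∈_)
open import Relation.Nullary using (¬_; Dec; yes; no)
open import Relation.Binary.PropositionalEquality using (_≡_; _≢_)
open import Data.Empty renaming (⊥ to ⊥')
open import Data.Unit renaming (⊤ to ⊤')

-- Scores range over a totally ordered abelian group (the paper uses ℝ, which
-- is not available in agda-stdlib; ℝ is an instance of this record).
-- Only +, negation and the order are used by all notions involved.
record OrderedAbelianGroup : Set₁ where
  infixl 6 _+_ _-_
  infix 4 _≤_ _<_
  field
    Carrier : Set
    _+_ : Carrier → Carrier → Carrier
    -_ : Carrier → Carrier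
    0# : Carrier
    +-assoc : ∀ a b c → (a + b) + c ≡ a + (b + c)
    +-comm : ∀ a b → a + b ≡ b + a
    +-identityʳ : ∀ a → a + 0# ≡ a
    +-inverseʳ : ∀ a → a + (- a) ≡ 0#
    _≤_ : Carrier → Carrier → Set
    ≤-refl : ∀ {a} → a ≤ a
    ≤-trans : ∀ {a b c} → a ≤ b → b ≤ c → a ≤ c
    ≤-antisym : ∀ {a b} → a ≤ b → b ≤ a → a ≡ b
    _≤?_ : ∀ a b → Dec (a ≤ b)
    ≤-total : ∀ a b → a ≤ b ⊎ b ≤ a
    +-monoˡ-≤ : ∀ {a b} c → a ≤ b → a + c ≤ b + c

  _-_ : Carrier → Carrier → Carrier
  a - b = a + (- b)

  _<_ : Carrier → Carrier → Set
  a < b = (a ≤ b) × (a ≢ b)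

  max : Carrier → Carrier → Carrier
  max a b with a ≤? b
  ... | yes _ = b
  ... | no _ = a

  min : Carrier → Carrier → Carrier
  min a b with a ≤? b
  ... | yes _ = a
  ... | no _ = b

module Games (O : OrderedAbelianGroup) where
  open OrderedAbelianGroup O

  mutual
    data Game : Set where
      ⟨_∣_⟩ : Side → Side → Game

    -- One side of a game: either ∅^s (no move, ending score s) or a
    -- finite nonempty list of options.
    data Side : Set where
      ∅^ : Carrier → Side
      opts : List⁺ Game → Side

  num : Carrier → Game
  num s = ⟨ ∅^ s ∣ ∅^ s ⟩

  IsNumber : Game → Set
  IsNumber G = Σ Carrier λ k → G ≡ num k

  mutual
    Ls : Game → Carrier
    Ls ⟨ ∅^ s ∣ _ ⟩ = s
    Ls ⟨ opts (g ∷ gs) ∣ _ ⟩ = maxRs (Rs g) gs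

    Rs : Game → Carrier
    Rs ⟨ _ ∣ ∅^ s ⟩ = s
    Rs ⟨ _ ∣ opts (g ∷ gs) ⟩ = minLs (Ls g) gs

    maxRs : Carrier → List Game → Carrier
    maxRs acc [] = acc
    maxRs acc (g ∷ gs) = maxRs (max acc (Rs g)) gs

    minLs : Carrier → List Game → Carrier
    minLs acc [] = acc
    minLs acc (g ∷ gs) = minLs (min acc (Ls g)) gs

  _∈⁺_ : Game → List⁺ Game → Set
  g ∈⁺ gs = g ∈ toList gs

  data IsLeftOption (g : Game) : Game → Set where
    lopt : ∀ {gs R} → g ∈⁺ gs → IsLeftOption g ⟨ opts gs ∣ R ⟩

  data IsRightOption (g : Game) : Game → Set where
    ropt : ∀ {L gs} → g ∈⁺ gs → IsRightOption g ⟨ L ∣ opts gs ⟩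

  data Position : Game → Game → Set where
    self  : ∀ {G} → Position G G
    viaL  : ∀ {H g G} → IsLeftOption g G → Position H g → Position H G
    viaR  : ∀ {H g G} → IsRightOption g G → Position H g → Position H G

  HasLeftOptions : Game → Set
  HasLeftOptions ⟨ L ∣ _ ⟩ = Σ (List⁺ Game) λ gs → L ≡ opts gs

  HasRightOptions : Game → Set
  HasRightOptions ⟨ _ ∣ R ⟩ = Σ (List⁺ Game) λ gs → R ≡ opts gs

  Dicotic : Game → Set
  Dicotic G = ∀ H → Position H G →
    (HasLeftOptions H → HasRightOptions H) × (HasRightOptions H → HasLeftOptions H)

  Nonzugzwang : Game → Set
  Nonzugzwang G = ∀ H → Position H G → Rs H ≤ Ls H

  -- G + x for a number x, as given by the definition of disjunctive sum
  -- (the number x has no options, so only G moves; an empty side ∅^ℓ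
  -- becomes ∅^(ℓ + x)).
  mutual
    _+ₙ_ : Game → Carrier → Game
    ⟨ L ∣ R ⟩ +ₙ x = ⟨ sideAdd L x ∣ sideAdd R x ⟩

    sideAdd : Side → Carrier → Side
    sideAdd (∅^ s) x = ∅^ (s + x)
    sideAdd (opts (g ∷ gs)) x = opts ((g +ₙ x) ∷ listAdd gs x)

    listAdd : List Game → Carrier → List Game
    listAdd [] x = []
    listAdd (g ∷ gs) x = (g +ₙ x) ∷ listAdd gs x

  -- Cooling, given relationally:
  --   Cooled G t H   means  H = G_t
  --   CooledT G t H  means  H = G̃_t
  -- (the paper asserts that σ(G) exists, so these relations are functional
  -- and total; here they are characterised exactly as in the paper).
  mutual
    Cooled : Game → Carrier → Game → Set
    Cooled G t H =
      (IsNumber G × H ≡ G)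
      ⊎ ((¬ IsNumber G) × Σ Carrier λ σ → IsSigma G σ ×
          ((t ≤ σ × CooledT G t H)
           ⊎ (σ < t × Σ Game λ H̃ → CooledT G σ H̃ × H ≡ num (Ls H̃))))

    IsSigma : Game → Carrier → Set
    IsSigma G σ =
      (0# ≤ σ)
      × (Σ Game λ H̃ → CooledT G σ H̃ × Ls H̃ ≡ Rs H̃)
      × (∀ t' → 0# ≤ t' → t' < σ → ∀ H̃ → CooledT G t' H̃ → Ls H̃ ≢ Rs H̃)

    -- G̃_t = ⟨ { G^l_t - t } ∣ { G^r_t + t } ⟩
    CooledT : Game → Carrier → Game → Set
    CooledT ⟨ L ∣ R ⟩ t ⟨ L' ∣ R' ⟩ = CooledSide L (- t) t L' × CooledSide R t t R'

    CooledSide : Side → Carrier → Carrier → Side → Set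
    CooledSide (∅^ s) d t (∅^ s') = s' ≡ s
    CooledSide (∅^ s) d t (opts _) = ⊥'
    CooledSide (opts _) d t (∅^ _) = ⊥'
    CooledSide (opts (g ∷ gs)) d t (opts (h ∷ hs)) =
      CooledOpt g d t h × CooledList gs d t hs

    CooledList : List Game → Carrier → Carrier → List Game → Set
    CooledList [] d t [] = ⊤'
    CooledList [] d t (_ ∷ _) = ⊥'
    CooledList (_ ∷ _) d t [] = ⊥'
    CooledList (g ∷ gs) d t (h ∷ hs) = CooledOpt g d t h × CooledList gs d t hs

    CooledOpt : Game → Carrier → Carrier → Game → Set
    CooledOpt g d t h = Σ Game λ gt → Cooled g t gt × h ≡ gt +ₙ d

{-# OPTIONS --safe #-}
-- If t ≤ σ(G), a cooled Left option G^l_t has Right score in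
-- [Rs G^l, Rs G^l + t], so after the shift by -t it lies in [Rs G^l - t, Rs G^l]; max, min
-- and translation preserve such windows, giving Ls G - t ≤ Ls G_t ≤ Ls G, and symmetrically
-- Rs G ≤ Rs G_t ≤ Rs G + t. If t > σ(G), G_t is the number Ls G̃_σ = Rs G̃_σ, which by the
-- first case lies in both windows for σ < t. As cooling is given as a relation, the
-- equality Ls G̃_σ = Rs G̃_σ for the G̃_σ at hand needs σ(G) and G̃_σ to be unique.
module Submission where

open import Algebra.Bundles using (AbelianGroup)
open import Algebra.Construct.NaturalChoice.Base using (MaxOperator; MinOperator)
import Algebra.Construct.NaturalChoice.MaxOp as MaxOp
import Algebra.Construct.NaturalChoice.MinOp as MinOp
open import Algebra.Consequences.Propositional using (comm∧idʳ⇒id; comm∧invʳ⇒inv)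
import Algebra.Properties.AbelianGroup as AbelianGroupProperties
open import Data.List using ([]; _∷_)
open import Data.List.NonEmpty using (_∷_)
open import Data.Product using (_×_; _,_; proj₁; proj₂)
open import Data.Sum using (inj₁; inj₂)
open import Relation.Binary.Bundles using (TotalOrder; DecTotalOrder)
import Relation.Binary.Properties.DecTotalOrder as DecTotalOrderProperties
import Relation.Binary.Properties.Poset as PosetProperties
import Relation.Binary.Properties.TotalOrder as TotalOrderProperties
import Relation.Binary.Reasoning.PartialOrder as ≤-Reasoning
open import Relation.Binary.PropositionalEquality
  using (_≡_; refl; sym; cong; cong₂; subst; subst₂; isEquivalence; module ≡-Reasoning)
open import Relation.Nullary using (¬_; yes; no; contradiction)

open import Defs

module OrderedAbelianGroupProperties (O : OrderedAbelianGroup) where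
  open OrderedAbelianGroup O

  +-abelianGroup : AbelianGroup _ _
  +-abelianGroup = record
    { Carrier = Carrier
    ; _≈_ = _≡_
    ; _∙_ = _+_
    ; ε = 0#
    ; _⁻¹ = -_
    ; isAbelianGroup = record
      { isGroup = record
        { isMonoid = record
          { isSemigroup = record
            { isMagma = record { isEquivalence = isEquivalence ; ∙-cong = cong₂ _+_ }
            ; assoc = +-assoc
            }
          ; identity = comm∧idʳ⇒id +-comm +-identityʳ
          }
        ; inverse = comm∧invʳ⇒inv +-comm +-inverseʳ
        ; ⁻¹-cong = cong (-_)
        }
      ; comm = +-comm
      }
    }

  open AbelianGroupProperties +-abelianGroup
    using (xyx⁻¹≈y; //-rightDividesˡ; //-rightDividesʳ)

  ≤-totalOrder : TotalOrder _ _ _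
  ≤-totalOrder = record
    { Carrier = Carrier
    ; _≈_ = _≡_
    ; _≤_ = _≤_
    ; isTotalOrder = record
      { isPartialOrder = record
        { isPreorder = record
          { isEquivalence = isEquivalence
          ; reflexive = λ { refl → ≤-refl }
          ; trans = ≤-trans
          }
        ; antisym = ≤-antisym
        }
      ; total = ≤-total
      }
    }

  ≤-decTotalOrder : DecTotalOrder _ _ _
  ≤-decTotalOrder = TotalOrderProperties.decTotalOrder ≤-totalOrder
    (PosetProperties.≤-dec⇒≈-dec (TotalOrder.poset ≤-totalOrder) _≤?_)

  open DecTotalOrderProperties ≤-decTotalOrder public using (≮⇒≥; <⇒≱)

  max-operator : MaxOperator (TotalOrder.totalPreorder ≤-totalOrder)
  max-operator = record { _⊔_ = max ; x≤y⇒x⊔y≈y = x≤y⇒max≡y ; x≥y⇒x⊔y≈x = y≤x⇒max≡x }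
    where
    x≤y⇒max≡y : ∀ {x y} → x ≤ y → max x y ≡ y
    x≤y⇒max≡y {x} {y} x≤y with x ≤? y
    ... | yes _ = refl
    ... | no x≰y = contradiction x≤y x≰y
    y≤x⇒max≡x : ∀ {x y} → y ≤ x → max x y ≡ x
    y≤x⇒max≡x {x} {y} y≤x with x ≤? y
    ... | yes x≤y = ≤-antisym y≤x x≤y
    ... | no _ = refl

  min-operator : MinOperator (TotalOrder.totalPreorder ≤-totalOrder)
  min-operator = record { _⊓_ = min ; x≤y⇒x⊓y≈x = x≤y⇒min≡x ; x≥y⇒x⊓y≈y = y≤x⇒min≡y }
    where
    x≤y⇒min≡x : ∀ {x y} → x ≤ y → min x y ≡ x
    x≤y⇒min≡x {x} {y} x≤y with x ≤? y
    ... | yes _ = refl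
    ... | no x≰y = contradiction x≤y x≰y
    y≤x⇒min≡y : ∀ {x y} → y ≤ x → min x y ≡ y
    y≤x⇒min≡y {x} {y} y≤x with x ≤? y
    ... | yes x≤y = ≤-antisym x≤y y≤x
    ... | no _ = refl

  open MaxOp max-operator using (⊔-mono-≤; mono-≤-distrib-⊔)
  open MinOp min-operator using (⊓-mono-≤; mono-≤-distrib-⊓)

  open ≤-Reasoning (TotalOrder.poset ≤-totalOrder)

  +-monoʳ-≤ : ∀ z {x y} → x ≤ y → z + x ≤ z + y
  +-monoʳ-≤ z {x} {y} x≤y = subst₂ _≤_ (+-comm x z) (+-comm y z) (+-monoˡ-≤ z x≤y)

  x≤x+y : ∀ {x y} → 0# ≤ y → x ≤ x + y
  x≤x+y {x} {y} 0≤y = begin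
    x       ≡⟨ +-identityʳ x ⟨
    x + 0#  ≤⟨ +-monoʳ-≤ x 0≤y ⟩
    x + y   ∎

  x≤y+z⇒x-z≤y : ∀ {x y z} → x ≤ y + z → x - z ≤ y
  x≤y+z⇒x-z≤y {x} {y} {z} x≤y+z = begin
    x - z        ≤⟨ +-monoˡ-≤ (- z) x≤y+z ⟩
    (y + z) - z  ≡⟨ //-rightDividesʳ z y ⟩
    y            ∎

  +-distribʳ-max : ∀ z x y → max x y + z ≡ max (x + z) (y + z)
  +-distribʳ-max z = mono-≤-distrib-⊔ (cong (_+ z)) (+-monoˡ-≤ z)

  +-distribʳ-min : ∀ z x y → min x y + z ≡ min (x + z) (y + z)
  +-distribʳ-min z = mono-≤-distrib-⊓ (cong (_+ z)) (+-monoˡ-≤ z)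

  infix 4 _⊑[_]_
  _⊑[_]_ : Carrier → Carrier → Carrier → Set
  x ⊑[ t ] y = x ≤ y × y ≤ x + t

  ⊑-refl : ∀ {t x} → 0# ≤ t → x ⊑[ t ] x
  ⊑-refl 0≤t = ≤-refl , x≤x+y 0≤t

  ⊑-weaken : ∀ {s t x y} → s ≤ t → x ⊑[ s ] y → x ⊑[ t ] y
  ⊑-weaken {x = x} s≤t (x≤y , y≤x+s) = x≤y , ≤-trans y≤x+s (+-monoʳ-≤ x s≤t)

  ⊑-max : ∀ {t x x′ y y′} → x ⊑[ t ] y → x′ ⊑[ t ] y′ → max x x′ ⊑[ t ] max y y′
  ⊑-max {t} {x} {x′} {y} {y′} (x≤y , y≤x+t) (x′≤y′ , y′≤x′+t) = ⊔-mono-≤ x≤y x′≤y′ , (begin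
    max y y′              ≤⟨ ⊔-mono-≤ y≤x+t y′≤x′+t ⟩
    max (x + t) (x′ + t)  ≡⟨ +-distribʳ-max t x x′ ⟨
    max x x′ + t          ∎)

  ⊑-min : ∀ {t x x′ y y′} → x ⊑[ t ] y → x′ ⊑[ t ] y′ → min x x′ ⊑[ t ] min y y′
  ⊑-min {t} {x} {x′} {y} {y′} (x≤y , y≤x+t) (x′≤y′ , y′≤x′+t) = ⊓-mono-≤ x≤y x′≤y′ , (begin
    min y y′              ≤⟨ ⊓-mono-≤ y≤x+t y′≤x′+t ⟩
    min (x + t) (x′ + t)  ≡⟨ +-distribʳ-min t x x′ ⟨
    min x x′ + t          ∎)

  ⊑⇒y⊑x+t : ∀ {t x y} → x ⊑[ t ] y → y ⊑[ t ] x + t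
  ⊑⇒y⊑x+t {t} (x≤y , y≤x+t) = y≤x+t , +-monoˡ-≤ t x≤y

  ⊑⇒y-t⊑x : ∀ {t x y} → x ⊑[ t ] y → y - t ⊑[ t ] x
  ⊑⇒y-t⊑x {t} {x} {y} (x≤y , y≤x+t) =
    x≤y+z⇒x-z≤y y≤x+t , subst (x ≤_) (sym (//-rightDividesˡ t y)) x≤y

  ⊑⇒0≤y-x≤t : ∀ {t x y} → x ⊑[ t ] y → 0# ≤ y - x × y - x ≤ t
  ⊑⇒0≤y-x≤t {t} {x} {y} (x≤y , y≤x+t) = (begin
    0#         ≡⟨ +-inverseʳ x ⟨
    x - x      ≤⟨ +-monoˡ-≤ (- x) x≤y ⟩
    y - x      ∎) , (begin
    y - x      ≤⟨ +-monoˡ-≤ (- x) y≤x+t ⟩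
    x + t - x  ≡⟨ xyx⁻¹≈y x t ⟩
    t          ∎)

  ⊑⇒-t≤x-y≤0 : ∀ {t x y} → x ⊑[ t ] y → x - y ≤ 0# × - t ≤ x - y
  ⊑⇒-t≤x-y≤0 {t} {x} {y} (x≤y , y≤x+t) = (begin
    x - y      ≤⟨ +-monoˡ-≤ (- y) x≤y ⟩
    y - y      ≡⟨ +-inverseʳ y ⟩
    0#         ∎) , (begin
    - t        ≡⟨ xyx⁻¹≈y y (- t) ⟨
    y - t - y  ≤⟨ +-monoˡ-≤ (- y) (x≤y+z⇒x-z≤y y≤x+t) ⟩
    x - y      ∎)

module Cooling (O : OrderedAbelianGroup) where
  open OrderedAbelianGroup O
  open Games O
  open OrderedAbelianGroupProperties O
  open ≡-Reasoning

  mutual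
    Ls-+ₙ : ∀ G x → Ls (G +ₙ x) ≡ Ls G + x
    Ls-+ₙ ⟨ ∅^ _ ∣ _ ⟩ x = refl
    Ls-+ₙ ⟨ opts (g ∷ gs) ∣ _ ⟩ x = maxRs-listAdd gs x (Rs-+ₙ g x)

    Rs-+ₙ : ∀ G x → Rs (G +ₙ x) ≡ Rs G + x
    Rs-+ₙ ⟨ _ ∣ ∅^ _ ⟩ x = refl
    Rs-+ₙ ⟨ _ ∣ opts (g ∷ gs) ⟩ x = minLs-listAdd gs x (Ls-+ₙ g x)

    maxRs-listAdd : ∀ gs x {a b} → a ≡ b + x → maxRs a (listAdd gs x) ≡ maxRs b gs + x
    maxRs-listAdd [] x a≡b+x = a≡b+x
    maxRs-listAdd (g ∷ gs) x {a} {b} a≡b+x = maxRs-listAdd gs x (begin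
      max a (Rs (g +ₙ x))    ≡⟨ cong₂ max a≡b+x (Rs-+ₙ g x) ⟩
      max (b + x) (Rs g + x) ≡⟨ +-distribʳ-max x b (Rs g) ⟨
      max b (Rs g) + x       ∎)

    minLs-listAdd : ∀ gs x {a b} → a ≡ b + x → minLs a (listAdd gs x) ≡ minLs b gs + x
    minLs-listAdd [] x a≡b+x = a≡b+x
    minLs-listAdd (g ∷ gs) x {a} {b} a≡b+x = minLs-listAdd gs x (begin
      min a (Ls (g +ₙ x))    ≡⟨ cong₂ min a≡b+x (Ls-+ₙ g x) ⟩
      min (b + x) (Ls g + x) ≡⟨ +-distribʳ-min x b (Ls g) ⟨
      min b (Ls g) + x       ∎)

  IsSigma-minimal : ∀ {G σ σ′} → IsSigma G σ → IsSigma G σ′ → ¬ σ′ < σ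
  IsSigma-minimal (_ , _ , unsettled-below-σ) (0≤σ′ , (H̃ , G↦H̃ , settled) , _) σ′<σ =
    unsettled-below-σ _ 0≤σ′ σ′<σ H̃ G↦H̃ settled

  IsSigma-unique : ∀ {G σ₁ σ₂} → IsSigma G σ₁ → IsSigma G σ₂ → σ₁ ≡ σ₂
  IsSigma-unique s₁ s₂ = ≤-antisym (≮⇒≥ (IsSigma-minimal s₁ s₂)) (≮⇒≥ (IsSigma-minimal s₂ s₁))

  mutual
    Cooled-functional : ∀ G {t H₁ H₂} → Cooled G t H₁ → Cooled G t H₂ → H₁ ≡ H₂
    Cooled-functional G (inj₁ (_ , refl)) (inj₁ (_ , refl)) = refl
    Cooled-functional G (inj₁ (n , _)) (inj₂ (¬n , _)) = contradiction n ¬n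
    Cooled-functional G (inj₂ (¬n , _)) (inj₁ (n , _)) = contradiction n ¬n
    Cooled-functional G (inj₂ (_ , _ , s₁ , c₁)) (inj₂ (_ , _ , s₂ , c₂))
      with IsSigma-unique s₁ s₂ | c₁ | c₂
    ... | refl | inj₁ (_ , G↦H₁) | inj₁ (_ , G↦H₂) = CooledT-functional G G↦H₁ G↦H₂
    ... | refl | inj₂ (_ , _ , G↦H̃₁ , refl) | inj₂ (_ , _ , G↦H̃₂ , refl) =
      cong (λ H̃ → num (Ls H̃)) (CooledT-functional G G↦H̃₁ G↦H̃₂)
    ... | refl | inj₁ (t≤σ , _) | inj₂ (σ<t , _) = contradiction t≤σ (<⇒≱ σ<t)
    ... | refl | inj₂ (σ<t , _) | inj₁ (t≤σ , _) = contradiction t≤σ (<⇒≱ σ<t)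

    CooledT-functional : ∀ G {t H₁ H₂} → CooledT G t H₁ → CooledT G t H₂ → H₁ ≡ H₂
    CooledT-functional ⟨ L ∣ R ⟩ {H₁ = ⟨ _ ∣ _ ⟩} {⟨ _ ∣ _ ⟩} (l₁ , r₁) (l₂ , r₂) =
      cong₂ ⟨_∣_⟩ (CooledSide-functional L l₁ l₂) (CooledSide-functional R r₁ r₂)

    CooledSide-functional : ∀ S {d t S₁ S₂} → CooledSide S d t S₁ → CooledSide S d t S₂ → S₁ ≡ S₂
    CooledSide-functional (∅^ _) {S₁ = ∅^ _} {∅^ _} refl refl = refl
    CooledSide-functional (∅^ _) {S₁ = ∅^ _} {opts _} _ ()
    CooledSide-functional (∅^ _) {S₁ = opts _} ()
    CooledSide-functional (opts _) {S₁ = ∅^ _} ()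
    CooledSide-functional (opts _) {S₁ = opts _} {∅^ _} _ ()
    CooledSide-functional (opts (g ∷ gs)) {S₁ = opts (_ ∷ _)} {opts (_ ∷ _)} (o₁ , os₁) (o₂ , os₂) =
      cong₂ (λ h hs → opts (h ∷ hs)) (CooledOpt-functional g o₁ o₂) (CooledList-functional gs os₁ os₂)

    CooledList-functional : ∀ gs {d t hs₁ hs₂} → CooledList gs d t hs₁ → CooledList gs d t hs₂ → hs₁ ≡ hs₂
    CooledList-functional [] {hs₁ = []} {[]} _ _ = refl
    CooledList-functional [] {hs₁ = []} {_ ∷ _} _ ()
    CooledList-functional [] {hs₁ = _ ∷ _} ()
    CooledList-functional (_ ∷ _) {hs₁ = []} ()
    CooledList-functional (_ ∷ _) {hs₁ = _ ∷ _} {[]} _ ()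
    CooledList-functional (g ∷ gs) {hs₁ = _ ∷ _} {_ ∷ _} (o₁ , os₁) (o₂ , os₂) =
      cong₂ _∷_ (CooledOpt-functional g o₁ o₂) (CooledList-functional gs os₁ os₂)

    CooledOpt-functional : ∀ g {d t h₁ h₂} → CooledOpt g d t h₁ → CooledOpt g d t h₂ → h₁ ≡ h₂
    CooledOpt-functional g {d} (_ , c₁ , refl) (_ , c₂ , refl) = cong (_+ₙ d) (Cooled-functional g c₁ c₂)

  IsSigma-settled : ∀ G {σ H̃} → IsSigma G σ → CooledT G σ H̃ → Ls H̃ ≡ Rs H̃
  IsSigma-settled G (_ , (K̃ , G↦K̃ , settled) , _) G↦H̃ =
    subst (λ H → Ls H ≡ Rs H) (CooledT-functional G G↦K̃ G↦H̃) settled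

  CoolingBounds : Carrier → Game → Game → Set
  CoolingBounds t G H = Ls H ⊑[ t ] Ls G × Rs G ⊑[ t ] Rs H

  mutual
    Cooled-bounds : ∀ G {t H} → 0# ≤ t → Cooled G t H → CoolingBounds t G H
    Cooled-bounds G 0≤t (inj₁ (_ , refl)) = ⊑-refl 0≤t , ⊑-refl 0≤t
    Cooled-bounds G 0≤t (inj₂ (_ , _ , _ , inj₁ (_ , G↦H))) = CooledT-bounds G 0≤t G↦H
    Cooled-bounds G {t} 0≤t (inj₂ (_ , _ , s@(0≤σ , _) , inj₂ ((σ≤t , _) , _ , G↦H̃ , refl))) =
      let (Ls-bound , Rs-bound) = CooledT-bounds G 0≤σ G↦H̃ in
      ⊑-weaken σ≤t Ls-bound ,
      subst (Rs G ⊑[ t ]_) (sym (IsSigma-settled G s G↦H̃)) (⊑-weaken σ≤t Rs-bound)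

    CooledT-bounds : ∀ G {t H} → 0# ≤ t → CooledT G t H → CoolingBounds t G H
    CooledT-bounds G 0≤t G↦H = CooledT-Ls-bound G 0≤t G↦H , CooledT-Rs-bound G 0≤t G↦H

    CooledT-Ls-bound : ∀ G {t H} → 0# ≤ t → CooledT G t H → Ls H ⊑[ t ] Ls G
    CooledT-Ls-bound ⟨ ∅^ _ ∣ _ ⟩ {H = ⟨ ∅^ _ ∣ _ ⟩} 0≤t (refl , _) = ⊑-refl 0≤t
    CooledT-Ls-bound ⟨ ∅^ _ ∣ _ ⟩ {H = ⟨ opts _ ∣ _ ⟩} _ (() , _)
    CooledT-Ls-bound ⟨ opts _ ∣ _ ⟩ {H = ⟨ ∅^ _ ∣ _ ⟩} _ (() , _)
    CooledT-Ls-bound ⟨ opts (g ∷ gs) ∣ _ ⟩ {H = ⟨ opts (_ ∷ _) ∣ _ ⟩} 0≤t ((o , os) , _) =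
      maxRs-bound gs 0≤t os (option-Rs-bound g 0≤t o)

    CooledT-Rs-bound : ∀ G {t H} → 0# ≤ t → CooledT G t H → Rs G ⊑[ t ] Rs H
    CooledT-Rs-bound ⟨ _ ∣ ∅^ _ ⟩ {H = ⟨ _ ∣ ∅^ _ ⟩} 0≤t (_ , refl) = ⊑-refl 0≤t
    CooledT-Rs-bound ⟨ _ ∣ ∅^ _ ⟩ {H = ⟨ _ ∣ opts _ ⟩} _ (_ , ())
    CooledT-Rs-bound ⟨ _ ∣ opts _ ⟩ {H = ⟨ _ ∣ ∅^ _ ⟩} _ (_ , ())
    CooledT-Rs-bound ⟨ _ ∣ opts (g ∷ gs) ⟩ {H = ⟨ _ ∣ opts (_ ∷ _) ⟩} 0≤t (_ , (o , os)) =
      minLs-bound gs 0≤t os (option-Ls-bound g 0≤t o)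

    maxRs-bound : ∀ gs {t hs x y} → 0# ≤ t → CooledList gs (- t) t hs →
                  x ⊑[ t ] y → maxRs x hs ⊑[ t ] maxRs y gs
    maxRs-bound [] {hs = []} _ _ x⊑y = x⊑y
    maxRs-bound [] {hs = _ ∷ _} _ ()
    maxRs-bound (_ ∷ _) {hs = []} _ ()
    maxRs-bound (g ∷ gs) {hs = _ ∷ _} 0≤t (o , os) x⊑y =
      maxRs-bound gs 0≤t os (⊑-max x⊑y (option-Rs-bound g 0≤t o))

    minLs-bound : ∀ gs {t hs x y} → 0# ≤ t → CooledList gs t t hs →
                  x ⊑[ t ] y → minLs x gs ⊑[ t ] minLs y hs
    minLs-bound [] {hs = []} _ _ x⊑y = x⊑y
    minLs-bound [] {hs = _ ∷ _} _ ()
    minLs-bound (_ ∷ _) {hs = []} _ ()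
    minLs-bound (g ∷ gs) {hs = _ ∷ _} 0≤t (o , os) x⊑y =
      minLs-bound gs 0≤t os (⊑-min x⊑y (option-Ls-bound g 0≤t o))

    option-Rs-bound : ∀ g {t h} → 0# ≤ t → CooledOpt g (- t) t h → Rs h ⊑[ t ] Rs g
    option-Rs-bound g {t} 0≤t (gt , g↦gt , refl) rewrite Rs-+ₙ gt (- t) =
      ⊑⇒y-t⊑x (proj₂ (Cooled-bounds g 0≤t g↦gt))

    option-Ls-bound : ∀ g {t h} → 0# ≤ t → CooledOpt g t t h → Ls g ⊑[ t ] Ls h
    option-Ls-bound g {t} 0≤t (gt , g↦gt , refl) rewrite Ls-+ₙ gt t =
      ⊑⇒y⊑x+t (proj₁ (Cooled-bounds g 0≤t g↦gt))

proposition1 : (O : OrderedAbelianGroup) →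
    let open OrderedAbelianGroup O
        open Games O
    in ∀ (G : Game) (t : Carrier) → Dicotic G → Nonzugzwang G → 0# ≤ t →
       ∀ (Gt : Game) → Cooled G t Gt →
       ((0# ≤ Ls G - Ls Gt) × (Ls G - Ls Gt ≤ t))
       × ((Rs G - Rs Gt ≤ 0#) × (- t ≤ Rs G - Rs Gt))
proposition1 O G t _ _ 0≤t Gt G↦Gt =
  let open OrderedAbelianGroupProperties O
      open Cooling O
      (Ls-bound , Rs-bound) = Cooled-bounds G 0≤t G↦Gt
  in ⊑⇒0≤y-x≤t Ls-bound , ⊑⇒-t≤x-y≤0 Rs-bound
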